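{- Let $n\ge 2$ and $p\ge 1$ be integers, and let ${\cal OCT}_n$ be the set of order-preserving full contractions of $X_n=\{1,\dots,n\}$. Let $a_{n,p}$ be the number of $\alpha\in{\cal OCT}_n$ with $F(\alpha)=\{1\}$ and $h(\alpha)=p$. Then this equals the number of $\alpha\in{\cal OCT}_n$ with $F(\alpha)=\{n\}$ and $h(\alpha)=p$, and $a_{n,p}=\binom{n-2}{p-1}$.
   Context: Full transformations are maps $\alpha:X_n\to X_n$, written $x\mapsto x\alpha$. Order-preserving: $x\le y\Rightarrow x\alpha\le y\alpha$. Contraction: $|x\alpha-y\alpha|\le|x-y|$ for all $x,y$. $F(\alpha)=\{x:x\alpha=x\}$, $h(\alpha)=|\mathrm{Im}\,\alpha|$. -}

module Defs where

open import Data.Nat using (ℕ; zero; suc; ∣_-_∣) renaming (_≤_ to _≤ℕ_; _≤?_ to _≤ℕ?_)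
import Data.Nat.Properties as ℕP
open import Data.Fin using (Fin; zero; suc; _≤_; _≤?_)
open import Data.Fin.Properties using (all?; any?; _≟_)
open import Data.Fin.Subset using (Subset; ∣_∣)
open import Data.Vec using (Vec; []; _∷_; lookup; tabulate)
open import Data.List using (List; []; _∷_; [_]; map; concatMap; allFin; filter; length)
open import Data.Product using (_×_; ∃)
open import Relation.Binary.PropositionalEquality using (_≡_)
open import Relation.Nullary using (Dec; does; _×-dec_; _→-dec_)

-- X_n = {1,…,n} is modelled by Fin n (element k ↔ k+1).
-- A full transformation α : X_n → X_n is the vector (1α, …, nα);
-- x α is `lookup α x`.
Trans : ℕ → Set
Trans n = Vec (Fin n) n

allVecs : (m n : ℕ) → List (Vec (Fin n) m)
allVecs zero    n = [ [] ]
allVecs (suc m) n = concatMap (λ x → map (x ∷_) (allVecs m n)) (allFin n)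

allTrans : (n : ℕ) → List (Trans n)
allTrans n = allVecs n n

dist : {n : ℕ} → Fin n → Fin n → ℕ
dist x y = ∣ Data.Fin.toℕ x - Data.Fin.toℕ y ∣

OrderPreserving : {n : ℕ} → Trans n → Set
OrderPreserving α = ∀ x y → x ≤ y → lookup α x ≤ lookup α y

Contraction : {n : ℕ} → Trans n → Set
Contraction α = ∀ x y → dist (lookup α x) (lookup α y) ≤ℕ dist x y

IsOCT : {n : ℕ} → Trans n → Set
IsOCT α = OrderPreserving α × Contraction α

Fix : {n : ℕ} → Trans n → Subset n
Fix α = tabulate (λ x → does (lookup α x ≟ x))

Im : {n : ℕ} → Trans n → Subset n
Im α = tabulate (λ y → does (any? (λ x → lookup α x ≟ y)))

h : {n : ℕ} → Trans n → ℕ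
h α = ∣ Im α ∣

OrderPreserving? : {n : ℕ} (α : Trans n) → Dec (OrderPreserving α)
OrderPreserving? α = all? λ x → all? λ y → (x ≤? y) →-dec (lookup α x ≤? lookup α y)

Contraction? : {n : ℕ} (α : Trans n) → Dec (Contraction α)
Contraction? α = all? λ x → all? λ y → dist (lookup α x) (lookup α y) ≤ℕ? dist x y

IsOCT? : {n : ℕ} (α : Trans n) → Dec (IsOCT α)
IsOCT? α = OrderPreserving? α ×-dec Contraction? α

OCTFixRank : {n : ℕ} → Subset n → ℕ → Trans n → Set
OCTFixRank S p α = IsOCT α × Fix α ≡ S × h α ≡ p

OCTFixRank? : {n : ℕ} (S : Subset n) (p : ℕ) → (α : Trans n) → Dec (OCTFixRank S p α)
OCTFixRank? S p α = IsOCT? α ×-dec (Data.Vec.Properties.≡-dec Data.Bool.Properties._≟_ (Fix α) S) ×-dec (h α ℕP.≟ p)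
  where import Data.Vec.Properties; import Data.Bool.Properties

countOCT : (n : ℕ) → Subset n → ℕ → ℕ
countOCT n S p = length (filter (OCTFixRank? S p) (allTrans n))

module Submission where

-- An order-preserving contraction is a "stair": consecutive entries
-- differ by 0 or 1, its image is the interval from its first to its last
-- entry, and its rank is one more than its total climb (oct-rank).  If 1 is
-- the only fixed point, the stair starts at 1 with a flat step (fixed-first);
-- if n is the only fixed point, it ends at n with a flat step and therefore
-- starts at n − u (fixed-last).  Either way the rest is a walk of m free
-- steps climbing u.  Counting walks by their first step (#-cons) gives
-- Pascal's rule, hence m C u walks (walk-count, flatWalk-count).

open import Defs
open import Level using (0ℓ)
open import Data.Bool using (true; false)
open import Data.Nat using (ℕ; zero; suc; _+_; _∸_; _≤_; _<_; z≤n; s≤s; s≤s⁻¹; z<s; ∣_-_∣; _≟_; _≤?_; _<?_)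
open import Data.Nat.Properties
  using (+-0-monoid; +-suc; +-comm; +-identityʳ; +-monoʳ-≤; +-monoʳ-<; suc-injective; ≤-refl; ≤-reflexive; ≤-trans;
         ≤-antisym; ≤-total; <-trans; n≤1+n; n<1+n; m≤m+n; m+n≤o⇒m≤o; m+n≤o⇒n≤o; n≤0⇒n≡0; 1+n≢n; 1+n≰n;
         <⇒≱; ≤∧≢⇒<; ≰⇒>; m∸n≤m; m∸n+n≡m; m+n∸n≡m; m+[n∸m]≡n; m≤n⇒∣m-n∣≡n∸m; m≤n+o⇒m∸n≤o; ∣-∣-comm;
         module ≤-Reasoning)
open import Data.Nat.Combinatorics using (_C_; k>n⇒nCk≡0; nCk+nC[k+1]≡[n+1]C[k+1])
open import Data.Fin as Fin using (Fin; zero; suc; toℕ; fromℕ; fromℕ<; inject₁)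
import Data.Fin.Properties as Finₚ
open import Data.Fin.Properties using (toℕ-injective; toℕ<n; toℕ-fromℕ; toℕ-fromℕ<; toℕ-inject₁; ≤fromℕ; any?)
  renaming (_≟_ to _≟ᶠ_)
open import Data.Fin.Subset using (Subset; ⁅_⁆; ∣_∣; _∈_)
open import Data.Fin.Subset.Properties using (x∈⁅y⁆⇔x≡y; ∣p∣≤n)
open import Data.Vec using (Vec; []; _∷_; lookup; tabulate)
open import Data.Vec.Properties using (lookup∘tabulate; tabulate∘lookup; tabulate-cong; lookup⇒[]=; []=⇒lookup)
open import Data.List using (List; []; _∷_; _++_; concat; length; filter) renaming (tabulate to tabulateL; map to mapL)
open import Data.List.Properties
  using (filter-≐; filter-++; filter-none; filter-accept; filter-reject; length-++; map-tabulate)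
import Data.List.Relation.Unary.All as All
open import Data.Product using (_×_; _,_; proj₁; proj₂; ∃) renaming (map to map×; map₂ to map×₂)
open import Data.Sum using (_⊎_; inj₁; inj₂) renaming (map to map⊎)
open import Data.Empty using (⊥; ⊥-elim)
open import Function using (_∘_; _⇔_; mk⇔; Equivalence; case_of_)
open import Function.Construct.Identity using (⇔-id)
open import Function.Construct.Symmetry using (⇔-sym)
open import Function.Properties.Equivalence using () renaming (trans to ⇔-trans)
open import Relation.Binary.PropositionalEquality
open import Relation.Nullary using (Dec; yes; no; does; ¬_; _×-dec_; _⊎-dec_)
open import Relation.Nullary.Decidable using (does-⇔; dec-true; dec-false) renaming (map to map-dec)
open import Relation.Unary using (Pred; Decidable; _∪_)
open import Relation.Unary.Properties using (_∪?_)
open import Algebra.Properties.Monoid.Sum +-0-monoid using (sum; sum-cong-≗; sum-replicate-zero)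

open Equivalence using (to; from)

variable
  k M N : ℕ

module _ {N : ℕ} where

  # : {P : Pred (Vec (Fin N) k) 0ℓ} → Decidable P → ℕ
  # {k} P? = length (filter P? (allVecs k N))

  #-cong : {P Q : Pred (Vec (Fin N) k) 0ℓ} (P? : Decidable P) (Q? : Decidable Q) →
           (∀ v → P v ⇔ Q v) → # P? ≡ # Q?
  #-cong {k} P? Q? P⇔Q = cong length (filter-≐ P? Q? (to (P⇔Q _) , from (P⇔Q _)) (allVecs k N))

  #-empty : {P : Pred (Vec (Fin N) k) 0ℓ} (P? : Decidable P) → (∀ v → ¬ P v) → # P? ≡ 0
  #-empty {k} P? ¬P = cong length (filter-none P? (All.universal ¬P (allVecs k N)))

  #-∪ : {P Q : Pred (Vec (Fin N) k) 0ℓ} (P? : Decidable P) (Q? : Decidable Q) →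
        (∀ {v} → P v → Q v → ⊥) → # (P? ∪? Q?) ≡ # P? + # Q?
  #-∪ {k} P? Q? disjoint = go (allVecs k N)
    where
    go : ∀ vs → length (filter (P? ∪? Q?) vs) ≡ length (filter P? vs) + length (filter Q? vs)
    go []       = refl
    go (v ∷ vs) with P? v | Q? v
    ... | yes p | yes q = ⊥-elim (disjoint p q)
    ... | yes _ | no _  = cong suc (go vs)
    ... | no _  | yes _ = trans (cong suc (go vs)) (sym (+-suc _ _))
    ... | no _  | no _  = go vs

  #-cons : {P : Pred (Vec (Fin N) (suc k)) 0ℓ} (P? : Decidable P) →
           # P? ≡ sum (λ x → # (λ w → P? (x ∷ w)))
  #-cons {k} P? = begin
    length (filter P? (concat (mapL sections (tabulateL (λ x → x)))))
      ≡⟨ cong (λ xss → length (filter P? (concat xss))) (map-tabulate (λ x → x) sections) ⟩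
    length (filter P? (concat (tabulateL sections)))
      ≡⟨ concat-tabulate sections ⟩
    sum (λ x → length (filter P? (sections x)))
      ≡⟨ sum-cong-≗ (λ x → filter-map (x ∷_) (allVecs k N)) ⟩
    sum (λ x → # (λ w → P? (x ∷ w))) ∎
    where
    open ≡-Reasoning
    sections : Fin N → List (Vec (Fin N) (suc k))
    sections x = mapL (x ∷_) (allVecs k N)

    concat-tabulate : ∀ {n} (g : Fin n → List (Vec (Fin N) (suc k))) →
                      length (filter P? (concat (tabulateL g))) ≡ sum (λ i → length (filter P? (g i)))
    concat-tabulate {zero}  g = refl
    concat-tabulate {suc n} g = begin
      length (filter P? (g zero ++ concat (tabulateL (g ∘ suc))))
        ≡⟨ cong length (filter-++ P? (g zero) _) ⟩
      length (filter P? (g zero) ++ filter P? (concat (tabulateL (g ∘ suc))))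
        ≡⟨ length-++ (filter P? (g zero)) ⟩
      length (filter P? (g zero)) + length (filter P? (concat (tabulateL (g ∘ suc))))
        ≡⟨ cong (length (filter P? (g zero)) +_) (concat-tabulate (g ∘ suc)) ⟩
      length (filter P? (g zero)) + sum (λ i → length (filter P? (g (suc i))))
        ∎

    filter-map : (f : Vec (Fin N) k → Vec (Fin N) (suc k)) (vs : List (Vec (Fin N) k)) →
                 length (filter P? (mapL f vs)) ≡ length (filter (P? ∘ f) vs)
    filter-map f []       = refl
    filter-map f (v ∷ vs) with P? (f v)
    ... | yes _ = cong suc (filter-map f vs)
    ... | no _  = filter-map f vs

sum-point : ∀ {n} (f : Fin n → ℕ) (c : Fin n) → (∀ x → x ≢ c → f x ≡ 0) → sum f ≡ f c
sum-point {suc n} f zero vanish = begin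
  f zero + sum (f ∘ suc)      ≡⟨ cong (f zero +_) (sum-cong-≗ (λ x → vanish (suc x) λ ())) ⟩
  f zero + sum {n} (λ _ → 0)  ≡⟨ cong (f zero +_) (sum-replicate-zero n) ⟩
  f zero + 0                  ≡⟨ +-identityʳ (f zero) ⟩
  f zero                      ∎
  where open ≡-Reasoning
sum-point {suc n} f (suc c) vanish =
  cong₂ _+_ (vanish zero λ ()) (sum-point (f ∘ suc) c (λ x x≢c → vanish (suc x) (x≢c ∘ Finₚ.suc-injective)))

infixr 5 _◂_ _◂?_

_◂_ : ℕ → Pred (Vec (Fin M) k) 0ℓ → Pred (Vec (Fin M) (suc k)) 0ℓ
(a ◂ Q) (x ∷ w) = toℕ x ≡ a × Q w

_◂?_ : ∀ a {Q : Pred (Vec (Fin M) k) 0ℓ} → Decidable Q → Decidable (a ◂ Q)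
(a ◂? Q?) (x ∷ w) = (toℕ x ≟ a) ×-dec Q? w

#-◂ : ∀ {a} {Q : Pred (Vec (Fin N) k) 0ℓ} → a < N → (Q? : Decidable Q) → # (a ◂? Q?) ≡ # Q?
#-◂ {a = a} {Q} a<N Q? = begin
  # (a ◂? Q?)                               ≡⟨ #-cons (a ◂? Q?) ⟩
  sum (λ x → # (λ w → (a ◂? Q?) (x ∷ w)))  ≡⟨ sum-point _ c outside-c ⟩
  # (λ w → (a ◂? Q?) (c ∷ w))              ≡⟨ #-cong (λ w → (a ◂? Q?) (c ∷ w)) Q? at-c ⟩
  # Q?                                      ∎
  where
  open ≡-Reasoning
  c = fromℕ< a<N
  at-c : ∀ w → (a ◂ Q) (c ∷ w) ⇔ Q w
  at-c w = mk⇔ proj₂ (toℕ-fromℕ< a<N ,_)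
  outside-c : ∀ x → x ≢ c → # (λ w → (a ◂? Q?) (x ∷ w)) ≡ 0
  outside-c x x≢c = #-empty (λ w → (a ◂? Q?) (x ∷ w))
    λ w (x≡a , _) → x≢c (toℕ-injective (trans x≡a (sym (toℕ-fromℕ< a<N))))

#-flat-step : ∀ {a} {P : Pred (Vec (Fin N) (suc k)) 0ℓ} {Q : Pred (Vec (Fin N) k) 0ℓ} → a < N →
              (P? : Decidable P) (Q? : Decidable Q) → (∀ v → P v ⇔ (a ◂ Q) v) → # P? ≡ # Q?
#-flat-step {a = a} a<N P? Q? P⇔ = trans (#-cong P? (a ◂? Q?) P⇔) (#-◂ a<N Q?)

#-up-step : ∀ {a} {P : Pred (Vec (Fin N) (suc k)) 0ℓ} {Q R : Pred (Vec (Fin N) k) 0ℓ} → suc a < N →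
            (P? : Decidable P) (Q? : Decidable Q) (R? : Decidable R) →
            (∀ v → P v ⇔ ((a ◂ Q) ∪ (suc a ◂ R)) v) → # P? ≡ # Q? + # R?
#-up-step {a = a} {Q = Q} {R} a+1<N P? Q? R? P⇔ = begin
  # P?                               ≡⟨ #-cong P? ((a ◂? Q?) ∪? (suc a ◂? R?)) P⇔ ⟩
  # ((a ◂? Q?) ∪? (suc a ◂? R?))   ≡⟨ #-∪ (a ◂? Q?) (suc a ◂? R?) flat≠up ⟩
  # (a ◂? Q?) + # (suc a ◂? R?)    ≡⟨ cong₂ _+_ (#-◂ (<-trans (n<1+n a) a+1<N) Q?) (#-◂ a+1<N R?) ⟩
  # Q? + # R?                        ∎
  where
  open ≡-Reasoning
  flat≠up : ∀ {v} → (a ◂ Q) v → (suc a ◂ R) v → ⊥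
  flat≠up {_ ∷ _} (x≡a , _) (x≡1+a , _) = 1+n≢n (trans (sym x≡1+a) x≡a)

#-nil : ∀ u {P : Pred (Vec (Fin N) 0) 0ℓ} (P? : Decidable P) → P [] ⇔ u ≡ 0 → # P? ≡ 0 C u
#-nil zero    P? P⇔ = cong length (filter-accept P? (from P⇔ refl))
#-nil (suc u) P? P⇔ = cong length (filter-reject P? (λ p → case to P⇔ p of λ ()))

pascal : (B : ℕ) (f : ℕ → ℕ → ℕ → ℕ) →
         (∀ a u → a + u < B → f 0 a u ≡ 0 C u) →
         (∀ k a → a < B → f (suc k) a 0 ≡ f k a 0) →
         (∀ k a u → suc a + u < B → f (suc k) a (suc u) ≡ f k a (suc u) + f k (suc a) u) →
         ∀ k a u → a + u < B → f k a u ≡ k C u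
pascal B f base flat up = go
  where
  go : ∀ k a u → a + u < B → f k a u ≡ k C u
  go zero    a u       a+u<B = base a u a+u<B
  go (suc k) a zero    a<B   = trans (flat k a (m+n≤o⇒m≤o (suc a) a<B)) (go k a zero a<B)
  go (suc k) a (suc u) a+u<B = begin
    f (suc k) a (suc u)            ≡⟨ up k a u a+u<B′ ⟩
    f k a (suc u) + f k (suc a) u  ≡⟨ cong₂ _+_ (go k a (suc u) a+u<B) (go k (suc a) u a+u<B′) ⟩
    k C suc u + k C u              ≡⟨ +-comm (k C suc u) (k C u) ⟩
    k C u + k C suc u              ≡⟨ nCk+nC[k+1]≡[n+1]C[k+1] k u ⟩
    suc k C suc u                  ∎
    where
    open ≡-Reasoning
    a+u<B′ = subst (_< B) (+-suc a u) a+u<B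

-- Walk a u w: starting just after the value a, every entry of w equals its
-- predecessor or exceeds it by one, and the walk climbs exactly u in total.
data Walk {M : ℕ} : {k : ℕ} → ℕ → ℕ → Vec (Fin M) k → Set where
  done : ∀ {a} → Walk a 0 []
  flat : ∀ {k a u x} {w : Vec (Fin M) k} → toℕ x ≡ a → Walk a u w → Walk a u (x ∷ w)
  up   : ∀ {k a u x} {w : Vec (Fin M) k} → toℕ x ≡ suc a → Walk (suc a) u w → Walk a (suc u) (x ∷ w)

data FlatWalk {M : ℕ} : {k : ℕ} → ℕ → ℕ → Vec (Fin M) (suc k) → Set where
  stay : ∀ {a x} → toℕ x ≡ a → FlatWalk a 0 (x ∷ [])
  flat : ∀ {k a u x} {w : Vec (Fin M) (suc k)} → toℕ x ≡ a → FlatWalk a u w → FlatWalk a u (x ∷ w)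
  up   : ∀ {k a u x} {w : Vec (Fin M) (suc k)} → toℕ x ≡ suc a → FlatWalk (suc a) u w →
         FlatWalk a (suc u) (x ∷ w)

module _ {a : ℕ} where

  walk-nil : ∀ {u} → Walk {M} a u [] ⇔ u ≡ 0
  walk-nil = mk⇔ (λ { done → refl }) (λ { refl → done })

  walk-cons₀ : (v : Vec (Fin M) (suc k)) → Walk a 0 v ⇔ (a ◂ Walk a 0) v
  walk-cons₀ (x ∷ w) = mk⇔ (λ { (flat e p) → e , p }) (λ (e , p) → flat e p)

  walk-cons₊ : ∀ {u} (v : Vec (Fin M) (suc k)) →
               Walk a (suc u) v ⇔ ((a ◂ Walk a (suc u)) ∪ (suc a ◂ Walk (suc a) u)) v
  walk-cons₊ (x ∷ w) = mk⇔ (λ { (flat e p) → inj₁ (e , p) ; (up e p) → inj₂ (e , p) })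
                           (λ { (inj₁ (e , p)) → flat e p ; (inj₂ (e , p)) → up e p })

  flatWalk-one : ∀ {u} (v : Vec (Fin M) 1) → FlatWalk a u v ⇔ (a ◂ (λ _ → u ≡ 0)) v
  flatWalk-one (x ∷ []) = mk⇔ (λ { (stay e) → e , refl }) (λ { (e , refl) → stay e })

  flatWalk-cons₀ : (v : Vec (Fin M) (suc (suc k))) → FlatWalk a 0 v ⇔ (a ◂ FlatWalk a 0) v
  flatWalk-cons₀ (x ∷ w) = mk⇔ (λ { (flat e p) → e , p }) (λ (e , p) → flat e p)

  flatWalk-cons₊ : ∀ {u} (v : Vec (Fin M) (suc (suc k))) →
                   FlatWalk a (suc u) v ⇔ ((a ◂ FlatWalk a (suc u)) ∪ (suc a ◂ FlatWalk (suc a) u)) v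
  flatWalk-cons₊ (x ∷ w) = mk⇔ (λ { (flat e p) → inj₁ (e , p) ; (up e p) → inj₂ (e , p) })
                               (λ { (inj₁ (e , p)) → flat e p ; (inj₂ (e , p)) → up e p })

walk? : ∀ a u → Decidable (Walk {M} {k} a u)
walk? a u [] = map-dec (⇔-sym walk-nil) (u ≟ 0)
walk? a zero (x ∷ w) = map-dec (⇔-sym (walk-cons₀ (x ∷ w))) ((toℕ x ≟ a) ×-dec walk? a zero w)
walk? a (suc u) (x ∷ w) = map-dec (⇔-sym (walk-cons₊ (x ∷ w)))
  (((toℕ x ≟ a) ×-dec walk? a (suc u) w) ⊎-dec ((toℕ x ≟ suc a) ×-dec walk? (suc a) u w))

flatWalk? : ∀ a u → Decidable (FlatWalk {M} {k} a u)
flatWalk? {k = zero} a u (x ∷ []) =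
  map-dec (⇔-sym (flatWalk-one (x ∷ []))) ((toℕ x ≟ a) ×-dec (u ≟ 0))
flatWalk? {k = suc k} a zero (x ∷ w) =
  map-dec (⇔-sym (flatWalk-cons₀ (x ∷ w))) ((toℕ x ≟ a) ×-dec flatWalk? a zero w)
flatWalk? {k = suc k} a (suc u) (x ∷ w) = map-dec (⇔-sym (flatWalk-cons₊ (x ∷ w)))
  (((toℕ x ≟ a) ×-dec flatWalk? a (suc u) w) ⊎-dec ((toℕ x ≟ suc a) ×-dec flatWalk? (suc a) u w))

walk-count : ∀ {N} k a u → a + u < N → # (walk? {N} {k} a u) ≡ k C u
walk-count {N} = pascal N (λ k a u → # (walk? {N} {k} a u))
  (λ a u _ → #-nil u (walk? a u) walk-nil)
  (λ k a a<N → #-flat-step a<N (walk? a 0) (walk? a 0) walk-cons₀)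
  (λ k a u 1+a+u<N → #-up-step (m+n≤o⇒m≤o (suc (suc a)) 1+a+u<N)
                       (walk? a (suc u)) (walk? a (suc u)) (walk? (suc a) u) walk-cons₊)

flatWalk-count : ∀ {N} k a u → a + u < N → # (flatWalk? {N} {k} a u) ≡ k C u
flatWalk-count {N} = pascal N (λ k a u → # (flatWalk? {N} {k} a u))
  (λ a u a+u<N → trans (#-flat-step (m+n≤o⇒m≤o (suc a) a+u<N) (flatWalk? a u) (λ _ → u ≟ 0) flatWalk-one)
                        (#-nil u (λ _ → u ≟ 0) (⇔-id _)))
  (λ k a a<N → #-flat-step a<N (flatWalk? a 0) (flatWalk? a 0) flatWalk-cons₀)
  (λ k a u 1+a+u<N → #-up-step (m+n≤o⇒m≤o (suc (suc a)) 1+a+u<N)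
                       (flatWalk? a (suc u)) (flatWalk? a (suc u)) (flatWalk? (suc a) u) flatWalk-cons₊)

Monotone : Vec (Fin M) k → Set
Monotone v = ∀ i j → i Fin.≤ j → lookup v i Fin.≤ lookup v j

Contracting : Vec (Fin M) k → Set
Contracting v = ∀ i j → dist (lookup v i) (lookup v j) ≤ dist i j

Stair : ℕ → Vec (Fin M) (suc k) → Set
Stair u (x ∷ w) = Walk (toℕ x) u w

stair-tail : ∀ {u x y} {w : Vec (Fin M) k} → Stair u (x ∷ y ∷ w) → ∃ λ u′ → Stair u′ (y ∷ w)
stair-tail {u = u} {w = w} (flat y≡x p)          = u , subst (λ b → Walk b u w) (sym y≡x) p
stair-tail {w = w}         (up {u = u′} y≡1+x p) = u′ , subst (λ b → Walk b u′ w) (sym y≡1+x) p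

walk-rise : ∀ {a u} {w : Vec (Fin M) k} → Walk a u w → ∀ j →
            a ≤ toℕ (lookup w j) × toℕ (lookup w j) ≤ a + suc (toℕ j)
walk-rise {a = a} (flat x≡a p) zero    = ≤-reflexive (sym x≡a) , ≤-trans (≤-reflexive x≡a) (m≤m+n a 1)
walk-rise {a = a} (up x≡1+a p) zero    = ≤-trans (n≤1+n a) (≤-reflexive (sym x≡1+a)) ,
                                          ≤-reflexive (trans x≡1+a (+-comm 1 a))
walk-rise {a = a} (flat x≡a p) (suc j) = map×₂ (λ le → ≤-trans le (+-monoʳ-≤ a (n≤1+n _))) (walk-rise p j)
walk-rise {a = a} (up x≡1+a p) (suc j) =
  map× (≤-trans (n≤1+n a)) (λ le → ≤-trans le (≤-reflexive (sym (+-suc a (suc (toℕ j)))))) (walk-rise p j)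

stair-spread : ∀ {u} {α : Vec (Fin M) (suc k)} → Stair u α → ∀ i j → toℕ i ≤ toℕ j →
               toℕ (lookup α i) ≤ toℕ (lookup α j) ×
               toℕ (lookup α j) ≤ toℕ (lookup α i) + (toℕ j ∸ toℕ i)
stair-spread {α = x ∷ w}     s zero    zero    _         = ≤-refl , m≤m+n (toℕ x) 0
stair-spread {α = x ∷ w}     s zero    (suc j) _         = walk-rise s j
stair-spread {α = x ∷ y ∷ w} s (suc i) (suc j) (s≤s i≤j) = stair-spread (proj₂ (stair-tail s)) i j i≤j

stair-dist : ∀ {u} {α : Vec (Fin M) (suc k)} → Stair u α → ∀ i j → toℕ i ≤ toℕ j →
             dist (lookup α i) (lookup α j) ≤ dist i j
stair-dist {α = α} s i j i≤j = begin
  ∣ toℕ (lookup α i) - toℕ (lookup α j) ∣  ≡⟨ m≤n⇒∣m-n∣≡n∸m lo ⟩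
  toℕ (lookup α j) ∸ toℕ (lookup α i)     ≤⟨ m≤n+o⇒m∸n≤o _ _ hi ⟩
  toℕ j ∸ toℕ i                           ≡⟨ m≤n⇒∣m-n∣≡n∸m i≤j ⟨
  ∣ toℕ i - toℕ j ∣                        ∎
  where
  open ≤-Reasoning
  lo = proj₁ (stair-spread s i j i≤j)
  hi = proj₂ (stair-spread s i j i≤j)

stair-monotone : ∀ {u} {α : Vec (Fin M) (suc k)} → Stair u α → Monotone α
stair-monotone s i j i≤j = proj₁ (stair-spread s i j i≤j)

stair-contracting : ∀ {u} {α : Vec (Fin M) (suc k)} → Stair u α → Contracting α
stair-contracting {α = α} s i j with ≤-total (toℕ i) (toℕ j)
... | inj₁ i≤j = stair-dist s i j i≤j
... | inj₂ j≤i =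
  subst₂ _≤_ (∣-∣-comm (toℕ (lookup α j)) _) (∣-∣-comm (toℕ j) (toℕ i)) (stair-dist s j i j≤i)

-- … and conversely every monotone contracting vector is a stair, since
-- consecutive entries then differ by 0 or 1.
unit-step : ∀ {a b} → a ≤ b → ∣ a - b ∣ ≤ 1 → b ≡ a ⊎ b ≡ suc a
unit-step {zero}  {zero}        _         _         = inj₁ refl
unit-step {zero}  {suc zero}    _         _         = inj₂ refl
unit-step {zero}  {suc (suc b)} _         (s≤s ())
unit-step {suc a} {suc b}       (s≤s a≤b) a-b≤1     = map⊎ (cong suc) (cong suc) (unit-step a≤b a-b≤1)

monotone-stair : {α : Vec (Fin M) (suc k)} → Monotone α → Contracting α → ∃ λ u → Stair u α
monotone-stair {α = x ∷ []}    _    _     = 0 , done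
monotone-stair {α = x ∷ y ∷ w} mono contr
  with monotone-stair {α = y ∷ w} (λ i j → mono (suc i) (suc j) ∘ s≤s) (λ i j → contr (suc i) (suc j))
     | unit-step (mono zero (suc zero) z≤n) (contr zero (suc zero))
... | u , s | inj₁ y≡x   = u     , flat y≡x (subst (λ b → Walk b u w) y≡x s)
... | u , s | inj₂ y≡1+x = suc u , up y≡1+x (subst (λ b → Walk b u w) y≡1+x s)

walk-top : ∀ {a u x} {w : Vec (Fin M) k} → Walk a u w → toℕ x ≡ a →
           toℕ (lookup (x ∷ w) (fromℕ k)) ≡ a + u
walk-top {a = a} done         x≡a = trans x≡a (sym (+-identityʳ a))
walk-top         (flat y≡a p) _   = walk-top p y≡a
walk-top {a = a} (up {u = u} y≡1+a p) _ = trans (walk-top p y≡1+a) (sym (+-suc a u))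

stair-top : ∀ {u x} {w : Vec (Fin M) k} → Stair u (x ∷ w) → toℕ (lookup (x ∷ w) (fromℕ k)) ≡ toℕ x + u
stair-top s = walk-top s refl

walk-cover : ∀ {a u} {w : Vec (Fin M) k} → Walk a u w → ∀ t → a < t → t ≤ a + u →
             ∃ λ j → toℕ (lookup w j) ≡ t
walk-cover {a = a} done t a<t t≤a+0 = ⊥-elim (<⇒≱ a<t (≤-trans t≤a+0 (≤-reflexive (+-identityʳ a))))
walk-cover (flat _ p) t a<t t≤a+u = map× suc (λ e → e) (walk-cover p t a<t t≤a+u)
walk-cover {a = a} (up {u = u} x≡1+a p) t a<t t≤a+u with suc a ≟ t
... | yes 1+a≡t = zero , trans x≡1+a 1+a≡t
... | no 1+a≢t  = map× suc (λ e → e)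
                    (walk-cover p t (≤∧≢⇒< a<t 1+a≢t) (≤-trans t≤a+u (≤-reflexive (+-suc a u))))

InWindow : ℕ → ℕ → ℕ → Set
InWindow a w t = a ≤ t × t < a + w

inWindow? : ∀ a w t → Dec (InWindow a w t)
inWindow? a w t = (a ≤? t) ×-dec (t <? a + w)

#Fin : ∀ n {P : ℕ → Set} → (∀ t → Dec (P t)) → ℕ
#Fin n P? = ∣ tabulate {n = n} (λ y → does (P? (toℕ y))) ∣

#Fin-cong : ∀ n {P Q : ℕ → Set} (P? : ∀ t → Dec (P t)) (Q? : ∀ t → Dec (Q t)) →
            (∀ t → P t ⇔ Q t) → #Fin n P? ≡ #Fin n Q?
#Fin-cong n P? Q? P⇔Q =
  cong (∣_∣ {n = n}) (tabulate-cong {f = does ∘ P? ∘ toℕ} {g = does ∘ Q? ∘ toℕ}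
    (λ y → does-⇔ (P⇔Q (toℕ y)) (P? (toℕ y)) (Q? (toℕ y))))

window-size : ∀ n a w → a + w ≤ n → #Fin n (inWindow? a w) ≡ w
window-size zero    a       w       a+w≤0       = sym (n≤0⇒n≡0 (m+n≤o⇒n≤o a a+w≤0))
window-size (suc n) (suc a) w       (s≤s a+w≤n) =
  trans (#Fin-cong n (inWindow? (suc a) w ∘ suc) (inWindow? a w) (λ _ → mk⇔ (map× s≤s⁻¹ s≤s⁻¹) (map× s≤s s≤s)))
        (window-size n a w a+w≤n)
window-size (suc n) zero    (suc w) (s≤s w≤n)   = cong suc
  (trans (#Fin-cong n (inWindow? 0 (suc w) ∘ suc) (inWindow? 0 w)
                     (λ _ → mk⇔ (λ (_ , lt) → z≤n , s≤s⁻¹ lt) (λ (_ , lt) → z≤n , s≤s lt)))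
         (window-size n zero w w≤n))
window-size (suc n) zero    zero    _           =
  trans (#Fin-cong n (inWindow? 0 0 ∘ suc) (inWindow? 0 0) (λ _ → mk⇔ (λ { (_ , ()) }) (λ { (_ , ()) })))
        (window-size n zero zero z≤n)

stair-image : ∀ {u x} {w : Vec (Fin M) k} → Stair u (x ∷ w) → ∀ y →
              (∃ λ i → lookup (x ∷ w) i ≡ y) ⇔ InWindow (toℕ x) (suc u) (toℕ y)
stair-image {k = k} {u} {x} {w} s y = mk⇔ attained covered
  where
  attained : (∃ λ i → lookup (x ∷ w) i ≡ y) → InWindow (toℕ x) (suc u) (toℕ y)
  attained (i , refl) = proj₁ (stair-spread s zero i z≤n) , (begin-strict
    toℕ (lookup (x ∷ w) i)          ≤⟨ proj₁ (stair-spread s i (fromℕ k) (≤fromℕ i)) ⟩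
    toℕ (lookup (x ∷ w) (fromℕ k))  ≡⟨ stair-top s ⟩
    toℕ x + u                        <⟨ +-monoʳ-< (toℕ x) (n<1+n u) ⟩
    toℕ x + suc u                    ∎)
    where open ≤-Reasoning
  covered : InWindow (toℕ x) (suc u) (toℕ y) → ∃ λ i → lookup (x ∷ w) i ≡ y
  covered (x≤y , y<x+u+1) with toℕ x ≟ toℕ y
  ... | yes x≡y = zero , toℕ-injective x≡y
  ... | no x≢y  = map× suc toℕ-injective (walk-cover s (toℕ y) (≤∧≢⇒< x≤y x≢y) y≤x+u)
    where y≤x+u = s≤s⁻¹ (subst (toℕ y <_) (+-suc (toℕ x) u) y<x+u+1)

stair-h : ∀ {u} (α : Trans (suc k)) → Stair u α → h α ≡ suc u
stair-h {k} {u} (x ∷ w) s = begin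
  h (x ∷ w)                                 ≡⟨ cong ∣_∣ (tabulate-cong image≡window) ⟩
  #Fin (suc k) (inWindow? (toℕ x) (suc u))  ≡⟨ window-size (suc k) (toℕ x) (suc u) fits ⟩
  suc u                                     ∎
  where
  open ≡-Reasoning
  image≡window : ∀ y → does (any? (λ i → lookup (x ∷ w) i ≟ᶠ y)) ≡ does (inWindow? (toℕ x) (suc u) (toℕ y))
  image≡window y =
    does-⇔ (stair-image s y) (any? (λ i → lookup (x ∷ w) i ≟ᶠ y)) (inWindow? (toℕ x) (suc u) (toℕ y))
  fits : toℕ x + suc u ≤ suc k
  fits = subst (_≤ suc k) (sym (+-suc (toℕ x) u)) (subst (_< suc k) (stair-top s) (toℕ<n _))

oct-rank : ∀ {u} (α : Trans (suc k)) → (IsOCT α × h α ≡ suc u) ⇔ Stair u α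
oct-rank α = mk⇔
  (λ ((mono , contr) , rank) → case monotone-stair mono contr of λ
     (_ , s) → subst (λ u → Stair u α) (suc-injective (trans (sym (stair-h α s)) rank)) s)
  (λ s → (stair-monotone s , stair-contracting s) , stair-h α s)

flatWalk⇒walk : ∀ {a u} {w : Vec (Fin M) (suc k)} → FlatWalk a u w → Walk a u w
flatWalk⇒walk (stay y≡a)   = flat y≡a done
flatWalk⇒walk (flat y≡a p) = flat y≡a (flatWalk⇒walk p)
flatWalk⇒walk (up y≡1+a p) = up y≡1+a (flatWalk⇒walk p)

flatWalk-end : ∀ {a u x} {w : Vec (Fin M) (suc k)} → FlatWalk a u w → toℕ x ≡ a →
               toℕ (lookup (x ∷ w) (inject₁ (fromℕ k))) ≡ toℕ (lookup (x ∷ w) (fromℕ (suc k)))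
flatWalk-end (stay y≡a)   x≡a = trans x≡a (sym y≡a)
flatWalk-end (flat y≡a p) _   = flatWalk-end p y≡a
flatWalk-end (up y≡1+a p) _   = flatWalk-end p y≡1+a

walk⇒flatWalk : ∀ {a u x} {w : Vec (Fin M) (suc k)} → Walk a u w → toℕ x ≡ a →
                toℕ (lookup (x ∷ w) (inject₁ (fromℕ k))) ≡ toℕ (lookup (x ∷ w) (fromℕ (suc k))) →
                FlatWalk a u w
walk⇒flatWalk {w = _ ∷ []}    (flat y≡a done)   _   _   = stay y≡a
walk⇒flatWalk {w = _ ∷ []}    (up y≡1+a done)   x≡a x≡y = ⊥-elim (1+n≢n (trans (sym y≡1+a) (trans (sym x≡y) x≡a)))
walk⇒flatWalk {w = _ ∷ _ ∷ _} (flat y≡a p)      _   eq  = flat y≡a (walk⇒flatWalk p y≡a eq)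
walk⇒flatWalk {w = _ ∷ _ ∷ _} (up y≡1+a p)      _   eq  = up y≡1+a (walk⇒flatWalk p y≡1+a eq)

fixed-points : ∀ {n} (α : Trans n) (S : Subset n) → Fix α ≡ S ⇔ (∀ x → lookup α x ≡ x ⇔ x ∈ S)
fixed-points α S = mk⇔
  (λ Fix≡S x → entry⇒fixed x (trans (sym (lookup∘tabulate _ x)) (cong (λ v → lookup v x) Fix≡S)))
  (λ fixed⇔ → trans (tabulate-cong (λ x → fixed⇒entry x (fixed⇔ x))) (tabulate∘lookup S))
  where
  witness : ∀ {P : Set} (P? : Dec P) → does P? ≡ true → P
  witness (yes p) _ = p

  entry⇒fixed : ∀ x → does (lookup α x ≟ᶠ x) ≡ lookup S x → lookup α x ≡ x ⇔ x ∈ S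
  entry⇒fixed x eq = mk⇔ (λ fx → lookup⇒[]= x S (trans (sym eq) (dec-true (lookup α x ≟ᶠ x) fx)))
                         (λ x∈S → witness (lookup α x ≟ᶠ x) (trans eq ([]=⇒lookup x∈S)))

  fixed⇒entry : ∀ x → (lookup α x ≡ x ⇔ x ∈ S) → does (lookup α x ≟ᶠ x) ≡ lookup S x
  fixed⇒entry x fixed⇔ with lookup S x in eq
  ... | true  = dec-true (lookup α x ≟ᶠ x) (from fixed⇔ (lookup⇒[]= x S eq))
  ... | false = dec-false (lookup α x ≟ᶠ x) (λ fx → case trans (sym eq) ([]=⇒lookup (to fixed⇔ fx)) of λ ())

unique-fixed-point : ∀ {n} (α : Trans n) (c : Fin n) → Fix α ≡ ⁅ c ⁆ ⇔ (∀ x → lookup α x ≡ x ⇔ x ≡ c)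
unique-fixed-point α c = mk⇔
  (λ Fix≡c x → ⇔-trans (to (fixed-points α ⁅ c ⁆) Fix≡c x) x∈⁅y⁆⇔x≡y)
  (λ fixed⇔ → from (fixed-points α ⁅ c ⁆) (λ x → ⇔-trans (fixed⇔ x) (⇔-sym x∈⁅y⁆⇔x≡y)))

fixed-first : ∀ {m u} (α : Trans (suc (suc m))) →
              OCTFixRank ⁅ zero ⁆ (suc u) α ⇔ (0 ◂ 0 ◂ Walk 0 u) α
fixed-first {u = u} α@(x ∷ y ∷ w) = mk⇔ forward backward
  where
  forward : OCTFixRank ⁅ zero ⁆ (suc u) α → (0 ◂ 0 ◂ Walk 0 u) α
  forward (oct , Fix≡1 , rank) = first-step-flat (to (oct-rank α) (oct , rank))
    where
    fixed⇔ = to (unique-fixed-point α zero) Fix≡1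
    x≡0 : toℕ x ≡ 0
    x≡0 = cong toℕ (from (fixed⇔ zero) refl)
    -- an up step at the start would make position 2 a fixed point
    first-step-flat : Stair u α → (0 ◂ 0 ◂ Walk 0 u) α
    first-step-flat (flat y≡x p) = x≡0 , trans y≡x x≡0 , subst (λ b → Walk b u w) x≡0 p
    first-step-flat (up y≡1+x _) =
      case to (fixed⇔ (suc zero)) (toℕ-injective (trans y≡1+x (cong suc x≡0))) of λ ()

  backward : (0 ◂ 0 ◂ Walk 0 u) α → OCTFixRank ⁅ zero ⁆ (suc u) α
  backward (x≡0 , y≡0 , p) = proj₁ oct×rank , from (unique-fixed-point α zero) only-first , proj₂ oct×rank
    where
    s : Stair u α
    s = flat (trans y≡0 (sym x≡0)) (subst (λ b → Walk b u w) (sym x≡0) p)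
    oct×rank = from (oct-rank α) s
    below : ∀ j → toℕ (lookup α (suc j)) ≤ toℕ j
    below j = subst (toℕ (lookup α (suc j)) ≤_) (cong (_+ toℕ j) y≡0)
                (proj₂ (stair-spread s (suc zero) (suc j) (s≤s z≤n)))
    only-first : ∀ z → lookup α z ≡ z ⇔ z ≡ zero
    only-first zero    = mk⇔ (λ _ → refl) (λ _ → toℕ-injective x≡0)
    only-first (suc j) =
      mk⇔ (λ αj≡j → ⊥-elim (1+n≰n (subst (_≤ toℕ j) (cong toℕ αj≡j) (below j)))) λ ()

-- The penultimate position m + 1 of X_{m+2} (zero-based index m).
penultimate : ∀ m → Fin (suc (suc m))
penultimate m = inject₁ (fromℕ m)

toℕ-penultimate : ∀ m → toℕ (penultimate m) ≡ m
toℕ-penultimate m = trans (toℕ-inject₁ (fromℕ m)) (toℕ-fromℕ m)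

-- If a stair ends at the top value m + 1, its penultimate entry is m or m + 1;
-- so unless the penultimate position is fixed, the last step is flat.
last-step-flat : ∀ {m u} (α : Trans (suc (suc m))) → Stair u α →
                 toℕ (lookup α (fromℕ (suc m))) ≡ suc m → lookup α (penultimate m) ≢ penultimate m →
                 toℕ (lookup α (penultimate m)) ≡ toℕ (lookup α (fromℕ (suc m)))
last-step-flat {m} α s top not-fixed =
  ≤-antisym (proj₁ spread) (≤-trans (≤-reflexive top) (≤∧≢⇒< m≤penult m≢penult))
  where
  last = fromℕ (suc m)
  penult = penultimate m
  spread = stair-spread s penult last (subst₂ _≤_ (sym (toℕ-penultimate m)) (sym (toℕ-fromℕ (suc m))) (n≤1+n m))
  m≤penult : m ≤ toℕ (lookup α penult)
  m≤penult = s≤s⁻¹ (begin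
    suc m                                             ≡⟨ top ⟨
    toℕ (lookup α last)                               ≤⟨ proj₂ spread ⟩
    toℕ (lookup α penult) + (toℕ last ∸ toℕ penult)  ≡⟨ cong (toℕ (lookup α penult) +_) one-step ⟩
    toℕ (lookup α penult) + 1                         ≡⟨ +-comm _ 1 ⟩
    suc (toℕ (lookup α penult))                       ∎)
    where
    open ≤-Reasoning
    one-step = trans (cong₂ _∸_ (toℕ-fromℕ (suc m)) (toℕ-penultimate m)) (m+n∸n≡m 1 m)
  m≢penult : m ≢ toℕ (lookup α penult)
  m≢penult m≡αp = not-fixed (toℕ-injective (trans (sym m≡αp) (sym (toℕ-penultimate m))))

above-diagonal : ∀ {m u} (α : Trans (suc (suc m))) → Stair u α →
                 toℕ (lookup α (penultimate m)) ≡ suc m → ∀ z → toℕ z ≤ m → toℕ (lookup α z) ≢ toℕ z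
above-diagonal {m} α s penult-top z z≤m αz≡z = 1+n≰n (begin
  suc m                                                ≡⟨ penult-top ⟨
  toℕ (lookup α (penultimate m))                       ≤⟨ proj₂ (stair-spread s z (penultimate m) z≤penult) ⟩
  toℕ (lookup α z) + (toℕ (penultimate m) ∸ toℕ z)    ≡⟨ cong₂ (λ a b → a + (b ∸ toℕ z)) αz≡z (toℕ-penultimate m) ⟩
  toℕ z + (m ∸ toℕ z)                                  ≡⟨ m+[n∸m]≡n z≤m ⟩
  m                                                    ∎)
  where
  open ≤-Reasoning
  z≤penult = subst (toℕ z ≤_) (sym (toℕ-penultimate m)) z≤m

fixed-last : ∀ {m u} → u ≤ suc m → (α : Trans (suc (suc m))) →
             OCTFixRank ⁅ fromℕ (suc m) ⁆ (suc u) α ⇔ (suc m ∸ u ◂ FlatWalk (suc m ∸ u) u) α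
fixed-last {m} {u} u≤1+m α@(x ∷ w) = mk⇔ forward backward
  where
  last = fromℕ (suc m)

  forward : OCTFixRank ⁅ last ⁆ (suc u) α → (suc m ∸ u ◂ FlatWalk (suc m ∸ u) u) α
  forward (oct , Fix≡n , rank) = x≡c , subst (λ b → FlatWalk b u w) x≡c (walk⇒flatWalk s refl flat-end)
    where
    s = to (oct-rank α) (oct , rank)
    fixed⇔ = to (unique-fixed-point α last) Fix≡n
    top : toℕ (lookup α last) ≡ suc m
    top = trans (cong toℕ (from (fixed⇔ last) refl)) (toℕ-fromℕ (suc m))
    x≡c : toℕ x ≡ suc m ∸ u
    x≡c = trans (sym (m+n∸n≡m (toℕ x) u)) (cong (_∸ u) (trans (sym (stair-top s)) top))
    penult≢last : penultimate m ≢ last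
    penult≢last eq = 1+n≢n (sym (trans (sym (toℕ-penultimate m)) (trans (cong toℕ eq) (toℕ-fromℕ (suc m)))))
    flat-end = last-step-flat α s top (penult≢last ∘ to (fixed⇔ (penultimate m)))

  backward : (suc m ∸ u ◂ FlatWalk (suc m ∸ u) u) α → OCTFixRank ⁅ last ⁆ (suc u) α
  backward (x≡c , p) = proj₁ oct×rank , from (unique-fixed-point α last) only-last , proj₂ oct×rank
    where
    p′ : FlatWalk (toℕ x) u w
    p′ = subst (λ b → FlatWalk b u w) (sym x≡c) p
    s : Stair u α
    s = flatWalk⇒walk p′
    oct×rank = from (oct-rank α) s
    top : toℕ (lookup α last) ≡ suc m
    top = trans (stair-top s) (trans (cong (_+ u) x≡c) (m∸n+n≡m u≤1+m))
    fixed⇒last : ∀ z → lookup α z ≡ z → z ≡ last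
    fixed⇒last z αz≡z with toℕ z ≤? m
    ... | yes z≤m = ⊥-elim (above-diagonal α s (trans (flatWalk-end p′ refl) top) z z≤m (cong toℕ αz≡z))
    ... | no z≰m  = toℕ-injective (trans (≤-antisym (s≤s⁻¹ (toℕ<n z)) (≰⇒> z≰m)) (sym (toℕ-fromℕ (suc m))))
    only-last : ∀ z → lookup α z ≡ z ⇔ z ≡ last
    only-last z = mk⇔ (fixed⇒last z) (λ { refl → toℕ-injective (trans top (sym (toℕ-fromℕ (suc m)))) })

count-rank-too-large : ∀ n S p → n < p → countOCT n S p ≡ 0
count-rank-too-large n S p n<p =
  #-empty (OCTFixRank? S p) (λ α (_ , _ , rank) → <⇒≱ n<p (subst (_≤ n) rank (∣p∣≤n (Im α))))

count-fixed-first : ∀ m u → u ≤ suc m → countOCT (suc (suc m)) ⁅ zero ⁆ (suc u) ≡ m C u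
count-fixed-first m u u≤1+m = begin
  countOCT (suc (suc m)) ⁅ zero ⁆ (suc u)  ≡⟨ #-cong (OCTFixRank? ⁅ zero ⁆ (suc u)) (0 ◂? 0 ◂? walks) fixed-first ⟩
  # (0 ◂? 0 ◂? walks)                      ≡⟨ #-◂ z<s (0 ◂? walks) ⟩
  # (0 ◂? walks)                           ≡⟨ #-◂ z<s walks ⟩
  # walks                                  ≡⟨ walk-count m 0 u (s≤s u≤1+m) ⟩
  m C u                                    ∎
  where
  open ≡-Reasoning
  walks = walk? {suc (suc m)} {m} 0 u

count-fixed-last : ∀ m u → u ≤ suc m → countOCT (suc (suc m)) ⁅ fromℕ (suc m) ⁆ (suc u) ≡ m C u
count-fixed-last m u u≤1+m = begin
  countOCT (suc (suc m)) ⁅ fromℕ (suc m) ⁆ (suc u)  ≡⟨ #-cong (OCTFixRank? _ (suc u)) (c ◂? walks) (fixed-last u≤1+m) ⟩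
  # (c ◂? walks)                                    ≡⟨ #-◂ (s≤s (m∸n≤m (suc m) u)) walks ⟩
  # walks                                           ≡⟨ flatWalk-count m c u (s≤s (≤-reflexive (m∸n+n≡m u≤1+m))) ⟩
  m C u                                             ∎
  where
  open ≡-Reasoning
  c = suc m ∸ u
  walks = flatWalk? {suc (suc m)} {m} c u

lemma2p2 : (m p : ℕ) → 1 ≤ p →
           countOCT (suc (suc m)) ⁅ zero ⁆ p ≡ countOCT (suc (suc m)) ⁅ fromℕ (suc m) ⁆ p
           × countOCT (suc (suc m)) ⁅ zero ⁆ p ≡ (suc (suc m) ∸ 2) C (p ∸ 1)
lemma2p2 m (suc u) _ with u ≤? suc m
... | yes u≤1+m = trans first (sym (count-fixed-last m u u≤1+m)) , first
  where first = count-fixed-first m u u≤1+m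
... | no u≰1+m  =
  trans (none ⁅ zero ⁆) (sym (none ⁅ fromℕ (suc m) ⁆)) , trans (none ⁅ zero ⁆) (sym (k>n⇒nCk≡0 m<u))
  where
  m<u = <-trans (n<1+n m) (≰⇒> u≰1+m)
  none : ∀ S → countOCT (suc (suc m)) S (suc u) ≡ 0
  none S = count-rank-too-large _ S (suc u) (s≤s (≰⇒> u≰1+m))
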